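{- If $(d_1,d_2,d_3,d_4)$ is ripe and $d_1\le d_2\le d_3\le d_4$, then $(d_1,d_2,d_3,d_4)$ is one of $(1,1,1,1)$, $(1,1,1,2)$, $(1,1,2,3)$, $(1,2,3,5)$, $(1,3,4,5)$, $(2,3,5,7)$, $(3,4,5,7)$.
   Context: A quadruple $(d_1,d_2,d_3,d_4)$ of positive integers with $N=\sum_j d_j$ is called ripe if: (i) $\gcd(d_j,N)=1$ for each $j$; (ii) for each $i$, writing $\{i,j,k,\ell\}=\{1,2,3,4\}$, $d_i$ divides one of $d_j+d_k$, $d_j+d_\ell$, $d_k+d_\ell$; (iii) for distinct indices $i\neq j$, if $d_j=d_i$ or $d_j=2d_i$, then $d_i=1$. -}

module Defs where

open import Data.Nat using (ℕ; _+_; _*_; _≤_; _>_)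
open import Data.Nat.Divisibility using (_∣_)
open import Data.Nat.GCD using (gcd)
open import Data.Fin using (Fin; zero; suc)
open import Data.Product using (_×_)
open import Data.Sum using (_⊎_)
open import Relation.Binary.PropositionalEquality using (_≡_; _≢_)

quad : ℕ → ℕ → ℕ → ℕ → Fin 4 → ℕ
quad a b c e zero = a
quad a b c e (suc zero) = b
quad a b c e (suc (suc zero)) = c
quad a b c e (suc (suc (suc zero))) = e

DividesPairSum : ℕ → ℕ → ℕ → ℕ → Set
DividesPairSum x y z w = (x ∣ y + z) ⊎ (x ∣ y + w) ⊎ (x ∣ z + w)

record Ripe (d₁ d₂ d₃ d₄ : ℕ) : Set where
  field
    positive : (i : Fin 4) → quad d₁ d₂ d₃ d₄ i > 0
    coprime  : (i : Fin 4) → gcd (quad d₁ d₂ d₃ d₄ i) (d₁ + d₂ + d₃ + d₄) ≡ 1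
    div₁ : DividesPairSum d₁ d₂ d₃ d₄
    div₂ : DividesPairSum d₂ d₁ d₃ d₄
    div₃ : DividesPairSum d₃ d₁ d₂ d₄
    div₄ : DividesPairSum d₄ d₁ d₂ d₃
    noDup : (i j : Fin 4) → i ≢ j →
            (quad d₁ d₂ d₃ d₄ j ≡ quad d₁ d₂ d₃ d₄ i
              ⊎ quad d₁ d₂ d₃ d₄ j ≡ 2 * quad d₁ d₂ d₃ d₄ i) →
            quad d₁ d₂ d₃ d₄ i ≡ 1

module Submission where

-- The largest entry d divides a sum of two entries, each at most d, so d equals that sum, or else
-- c = d and (iii) forces all entries to be 1. In each of the three cases, condition (ii) for c and
-- then for b again pins a sum of at most three entries not larger than the divisor to one, two or
-- three times it. This leaves finitely many patterns, each a multiple k·(e₁,e₂,e₃,e₄) of a fixed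
-- quadruple: (iii) kills the patterns with a repeated or doubled entry, and (i) forces k = 1 for the
-- others, because k divides both d₁ and N.

open import Defs
open import Data.Nat using (ℕ; suc; _+_; _*_; _≤_; _<_; z≤n; s≤s; s≤s⁻¹; >-nonZero)
open import Data.Nat.Properties
open import Data.Nat.Divisibility
  using (_∣_; divides; ∣-refl; ∣m∣n⇒∣m+n; ∣m+n∣m⇒∣n; n∣m*n; ∣1⇒≡1)
open import Data.Nat.GCD using (gcd-greatest)
open import Data.Nat.Tactic.RingSolver using (solve)
open import Data.Fin using (#_)
open import Data.Product using (_×_; _,_)
open import Data.Sum using (_⊎_; inj₁; inj₂; [_,_]′)
open import Data.Empty using (⊥-elim)
open import Data.List using (_∷_; [])
open import Relation.Nullary using (contradiction; yes; no)
open import Relation.Binary.PropositionalEquality using (_≡_; _≢_; refl; sym; trans; cong; subst)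

Listed : ℕ → ℕ → ℕ → ℕ → Set
Listed d₁ d₂ d₃ d₄ =
    (d₁ ≡ 1 × d₂ ≡ 1 × d₃ ≡ 1 × d₄ ≡ 1)
    ⊎ (d₁ ≡ 1 × d₂ ≡ 1 × d₃ ≡ 1 × d₄ ≡ 2)
    ⊎ (d₁ ≡ 1 × d₂ ≡ 1 × d₃ ≡ 2 × d₄ ≡ 3)
    ⊎ (d₁ ≡ 1 × d₂ ≡ 2 × d₃ ≡ 3 × d₄ ≡ 5)
    ⊎ (d₁ ≡ 1 × d₂ ≡ 3 × d₃ ≡ 4 × d₄ ≡ 5)
    ⊎ (d₁ ≡ 2 × d₂ ≡ 3 × d₃ ≡ 5 × d₄ ≡ 7)
    ⊎ (d₁ ≡ 3 × d₂ ≡ 4 × d₃ ≡ 5 × d₄ ≡ 7)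

listed-1111 : Listed 1 1 1 1
listed-1111 = inj₁ (refl , refl , refl , refl)

listed-1112 : Listed 1 1 1 2
listed-1112 = inj₂ (inj₁ (refl , refl , refl , refl))

listed-1123 : Listed 1 1 2 3
listed-1123 = inj₂ (inj₂ (inj₁ (refl , refl , refl , refl)))

listed-1235 : Listed 1 2 3 5
listed-1235 = inj₂ (inj₂ (inj₂ (inj₁ (refl , refl , refl , refl))))

listed-1345 : Listed 1 3 4 5
listed-1345 = inj₂ (inj₂ (inj₂ (inj₂ (inj₁ (refl , refl , refl , refl)))))

listed-2357 : Listed 2 3 5 7
listed-2357 = inj₂ (inj₂ (inj₂ (inj₂ (inj₂ (inj₁ (refl , refl , refl , refl))))))

listed-3457 : Listed 3 4 5 7
listed-3457 = inj₂ (inj₂ (inj₂ (inj₂ (inj₂ (inj₂ (refl , refl , refl , refl))))))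

m+m≡2*m : ∀ m → m + m ≡ 2 * m
m+m≡2*m m = cong (m +_) (sym (+-identityʳ m))

m+[m+m]≡3*m : ∀ m → m + (m + m) ≡ 3 * m
m+[m+m]≡3*m m = cong (m +_) (m+m≡2*m m)

m+m≢1 : ∀ m → m + m ≢ 1
m+m≢1 (suc m) e = m+1+n≢0 m (suc-injective e)

0<m+m⇒0<m : ∀ {m} → 0 < m + m → 0 < m
0<m+m⇒0<m {suc m} _ = s≤s z≤n

m+m≤n⇒m≢n : ∀ {m n} → 0 < n → m + m ≤ n → m ≢ n
m+m≤n⇒m≢n {n = n} 0<n m+m≤n refl = <⇒≱ (m<m+n n 0<n) m+m≤n

+-mono-≤-tight : ∀ {m n o p} → m ≤ n → o ≤ p → m + o ≡ n + p → m ≡ n × o ≡ p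
+-mono-≤-tight {m} {n} {o} {p} m≤n o≤p e =
  m≡n , +-cancelˡ-≡ n o p (trans (cong (_+ o) (sym m≡n)) e)
  where
  m≡n : m ≡ n
  m≡n = ≤-antisym m≤n (+-cancelʳ-≤ p n m (subst (_≤ m + p) e (+-monoʳ-≤ m o≤p)))

+-cancel-common : ∀ {u v} x y z → u ≡ v → u ≡ x + y → v ≡ x + z → y ≡ z
+-cancel-common x y z u≡v u≡x+y v≡x+z = +-cancelˡ-≡ x y z (trans (sym u≡x+y) (trans u≡v v≡x+z))

∣-drop-multiple : ∀ {d n} → d ∣ n → ∀ k m → n ≡ k * d + m → d ∣ m
∣-drop-multiple {d} d∣n k m n≡kd+m = ∣m+n∣m⇒∣n (subst (d ∣_) n≡kd+m d∣n) (n∣m*n k)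

quotient-≤ : ∀ {q d n} k → 0 < d → n ≡ q * d → n ≤ k * d → q ≤ k
quotient-≤ {q} {d} k 0<d n≡qd n≤kd =
  *-cancelʳ-≤ q k d {{>-nonZero 0<d}} (subst (_≤ k * d) n≡qd n≤kd)

∣-bounded-sum₂ : ∀ {x y z} → 0 < x → x ≤ z → y ≤ z → z ∣ x + y →
                 x + y ≡ z ⊎ (x ≡ z × y ≡ z)
∣-bounded-sum₂ {x} {y} {z} 0<x x≤z y≤z (divides q e) =
  by-quotient q (quotient-≤ 2 (≤-trans 0<x x≤z) e x+y≤2z) e
  where
  x+y≤2z : x + y ≤ 2 * z
  x+y≤2z = subst (x + y ≤_) (m+m≡2*m z) (+-mono-≤ x≤z y≤z)
  by-quotient : ∀ q → q ≤ 2 → x + y ≡ q * z → x + y ≡ z ⊎ (x ≡ z × y ≡ z)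
  by-quotient 0 _ e = contradiction (m+n≡0⇒m≡0 x e) (n>0⇒n≢0 0<x)
  by-quotient 1 _ e = inj₁ (trans e (*-identityˡ z))
  by-quotient 2 _ e = inj₂ (+-mono-≤-tight x≤z y≤z (trans e (sym (m+m≡2*m z))))
  by-quotient (suc (suc (suc _))) (s≤s (s≤s ())) _

∣-bounded-sum₃ : ∀ {x y w z} → 0 < x → x ≤ z → y ≤ z → w ≤ z → z ∣ x + (y + w) →
                 x + (y + w) ≡ z ⊎ x + (y + w) ≡ 2 * z ⊎ (x ≡ z × y ≡ z × w ≡ z)
∣-bounded-sum₃ {x} {y} {w} {z} 0<x x≤z y≤z w≤z (divides q e) =
  by-quotient q (quotient-≤ 3 (≤-trans 0<x x≤z) e s≤3z) e
  where
  s≤3z : x + (y + w) ≤ 3 * z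
  s≤3z = subst (x + (y + w) ≤_) (m+[m+m]≡3*m z) (+-mono-≤ x≤z (+-mono-≤ y≤z w≤z))
  by-quotient : ∀ q → q ≤ 3 → x + (y + w) ≡ q * z →
                x + (y + w) ≡ z ⊎ x + (y + w) ≡ 2 * z ⊎ (x ≡ z × y ≡ z × w ≡ z)
  by-quotient 0 _ e = contradiction (m+n≡0⇒m≡0 x e) (n>0⇒n≢0 0<x)
  by-quotient 1 _ e = inj₁ (trans e (*-identityˡ z))
  by-quotient 2 _ e = inj₂ (inj₁ e)
  by-quotient 3 _ e with +-mono-≤-tight x≤z (+-mono-≤ y≤z w≤z) (trans e (sym (m+[m+m]≡3*m z)))
  ... | x≡z , y+w≡z+z with +-mono-≤-tight y≤z w≤z y+w≡z+z
  ...   | y≡z , w≡z = inj₂ (inj₂ (x≡z , y≡z , w≡z))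
  by-quotient (suc (suc (suc (suc _)))) (s≤s (s≤s (s≤s ()))) _

ripe-0<d₁ : ∀ {a b c d} → Ripe a b c d → 0 < a
ripe-0<d₁ R = Ripe.positive R (# 0)

ripe-common-divisor : ∀ {a b c d k} → Ripe a b c d → k ∣ a → k ∣ b → k ∣ c → k ∣ d → k ≡ 1
ripe-common-divisor {k = k} R k∣a k∣b k∣c k∣d =
  ∣1⇒≡1 (subst (k ∣_) (Ripe.coprime R (# 0)) (gcd-greatest k∣a k∣N))
  where
  k∣N = ∣m∣n⇒∣m+n (∣m∣n⇒∣m+n (∣m∣n⇒∣m+n k∣a k∣b) k∣c) k∣d

ripe-c≡d : ∀ {a b c} → Ripe a b c c → a ≤ b → b ≤ c → Listed a b c c
ripe-c≡d R a≤b b≤c with Ripe.noDup R (# 2) (# 3) (λ ()) (inj₁ refl)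
... | refl with ≤-antisym b≤c (≤-trans (ripe-0<d₁ R) a≤b)
...   | refl with ≤-antisym a≤b (ripe-0<d₁ R)
...     | refl = listed-1111

ripe-d≡b+c-c≡a+b : ∀ {a b} → Ripe a b (a + b) (b + (a + b)) → a ≤ b →
                   Listed a b (a + b) (b + (a + b))
ripe-d≡b+c-c≡a+b {a} {b} R a≤b with ∣-bounded-sum₂ (ripe-0<d₁ R) a≤b a≤b b∣a+a
  where
  b∣a+a : b ∣ a + a
  b∣a+a with Ripe.div₂ R
  ... | inj₁ b∣a+c = ∣-drop-multiple b∣a+c 1 (a + a) (solve (a ∷ b ∷ []))
  ... | inj₂ (inj₁ b∣a+d) = ∣-drop-multiple b∣a+d 2 (a + a) (solve (a ∷ b ∷ []))
  ... | inj₂ (inj₂ b∣c+d) = ∣-drop-multiple b∣c+d 3 (a + a) (solve (a ∷ b ∷ []))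
... | inj₁ refl with Ripe.noDup R (# 0) (# 1) (λ ()) (inj₂ (m+m≡2*m a))
...   | refl = listed-1235
ripe-d≡b+c-c≡a+b R a≤b | inj₂ (refl , _) with Ripe.noDup R (# 0) (# 1) (λ ()) (inj₁ refl)
...   | refl = listed-1123

ripe-d≡b+c : ∀ {a b c} → Ripe a b c (b + c) → a ≤ b → b ≤ c → Listed a b c (b + c)
ripe-d≡b+c {a} {b} {c} R a≤b b≤c with c∣a+b⊎c∣b+b
  where
  c∣a+b⊎c∣b+b : c ∣ a + b ⊎ c ∣ b + b
  c∣a+b⊎c∣b+b with Ripe.div₃ R
  ... | inj₁ c∣a+b = inj₁ c∣a+b
  ... | inj₂ (inj₁ c∣a+d) = inj₁ (∣-drop-multiple c∣a+d 1 (a + b) (solve (a ∷ b ∷ c ∷ [])))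
  ... | inj₂ (inj₂ c∣b+d) = inj₂ (∣-drop-multiple c∣b+d 1 (b + b) (solve (b ∷ c ∷ [])))
... | inj₁ c∣a+b with ∣-bounded-sum₂ (ripe-0<d₁ R) (≤-trans a≤b b≤c) b≤c c∣a+b
...   | inj₁ refl = ripe-d≡b+c-c≡a+b R a≤b
...   | inj₂ (refl , refl) with Ripe.noDup R (# 1) (# 2) (λ ()) (inj₁ refl)
...     | refl = listed-1112
ripe-d≡b+c {b = b} R a≤b b≤c | inj₂ c∣b+b
  with ∣-bounded-sum₂ (≤-trans (ripe-0<d₁ R) a≤b) b≤c b≤c c∣b+b
... | inj₁ refl with Ripe.noDup R (# 1) (# 2) (λ ()) (inj₂ (m+m≡2*m b))
...   | refl with ≤-antisym a≤b (ripe-0<d₁ R)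
...     | refl = listed-1123
ripe-d≡b+c R a≤b b≤c | inj₂ c∣b+b | inj₂ (refl , _)
  with Ripe.noDup R (# 1) (# 2) (λ ()) (inj₁ refl)
... | refl with ≤-antisym a≤b (ripe-0<d₁ R)
...     | refl = listed-1112

ripe-d≡a+c-c≡a+b : ∀ {a b} → Ripe a b (a + b) (a + (a + b)) → a ≤ b →
                   Listed a b (a + b) (a + (a + b))
ripe-d≡a+c-c≡a+b {a} {b} R a≤b with b∣a+a⊎b∣3a
  where
  b∣a+a⊎b∣3a : b ∣ a + a ⊎ b ∣ a + (a + a)
  b∣a+a⊎b∣3a with Ripe.div₂ R
  ... | inj₁ b∣a+c = inj₁ (∣-drop-multiple b∣a+c 1 (a + a) (solve (a ∷ b ∷ [])))
  ... | inj₂ (inj₁ b∣a+d) = inj₂ (∣-drop-multiple b∣a+d 1 (a + (a + a)) (solve (a ∷ b ∷ [])))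
  ... | inj₂ (inj₂ b∣c+d) = inj₂ (∣-drop-multiple b∣c+d 2 (a + (a + a)) (solve (a ∷ b ∷ [])))
... | inj₁ b∣a+a with ∣-bounded-sum₂ (ripe-0<d₁ R) a≤b a≤b b∣a+a
...   | inj₁ refl = ⊥-elim (m+m≢1 a (Ripe.noDup R (# 1) (# 3) (λ ()) (inj₂ d≡2b)))
  where
  d≡2b : a + (a + (a + a)) ≡ 2 * (a + a)
  d≡2b = trans (sym (+-assoc a a (a + a))) (m+m≡2*m (a + a))
...   | inj₂ (refl , _) with Ripe.noDup R (# 0) (# 1) (λ ()) (inj₁ refl)
...     | refl = listed-1123
ripe-d≡a+c-c≡a+b {a} R a≤b | inj₂ b∣3a with ∣-bounded-sum₃ (ripe-0<d₁ R) a≤b a≤b a≤b b∣3a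
... | inj₁ refl with ripe-common-divisor R ∣-refl (divides 3 (solve (a ∷ [])))
                       (divides 4 (solve (a ∷ []))) (divides 5 (solve (a ∷ [])))
...   | refl = listed-1345
ripe-d≡a+c-c≡a+b {a} R a≤b | inj₂ b∣3a | inj₂ (inj₁ 3a≡2b) with m≤n⇒∃[o]m+o≡n a≤b
... | k , refl with +-cancel-common (a + a) a (k + k) 3a≡2b (solve (a ∷ [])) (solve (a ∷ k ∷ []))
...   | refl with ripe-common-divisor {k = k} R (divides 2 (solve (k ∷ [])))
                   (divides 3 (solve (k ∷ []))) (divides 5 (solve (k ∷ []))) (divides 7 (solve (k ∷ [])))
...     | refl = listed-2357
ripe-d≡a+c-c≡a+b R a≤b | inj₂ b∣3a | inj₂ (inj₂ (refl , _))
  with Ripe.noDup R (# 0) (# 1) (λ ()) (inj₁ refl)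
... | refl = listed-1123

ripe-d≡a+c : ∀ {a b c} → Ripe a b c (a + c) → a ≤ b → b ≤ c → Listed a b c (a + c)
ripe-d≡a+c {a} {b} {c} R a≤b b≤c with c∣a+b⊎c∣a+a
  where
  c∣a+b⊎c∣a+a : c ∣ a + b ⊎ c ∣ a + a
  c∣a+b⊎c∣a+a with Ripe.div₃ R
  ... | inj₁ c∣a+b = inj₁ c∣a+b
  ... | inj₂ (inj₁ c∣a+d) = inj₂ (∣-drop-multiple c∣a+d 1 (a + a) (solve (a ∷ c ∷ [])))
  ... | inj₂ (inj₂ c∣b+d) = inj₁ (∣-drop-multiple c∣b+d 1 (a + b) (solve (a ∷ b ∷ c ∷ [])))
... | inj₁ c∣a+b with ∣-bounded-sum₂ (ripe-0<d₁ R) (≤-trans a≤b b≤c) b≤c c∣a+b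
...   | inj₁ refl = ripe-d≡a+c-c≡a+b R a≤b
...   | inj₂ (refl , refl) with Ripe.noDup R (# 1) (# 2) (λ ()) (inj₁ refl)
...     | refl = listed-1112
ripe-d≡a+c {a} R a≤b b≤c | inj₂ c∣a+a
  with ∣-bounded-sum₂ (ripe-0<d₁ R) (≤-trans a≤b b≤c) (≤-trans a≤b b≤c) c∣a+a
... | inj₁ refl with Ripe.noDup R (# 0) (# 2) (λ ()) (inj₂ (m+m≡2*m a))
...   | refl with m≤n⇒m<n∨m≡n b≤c
...     | inj₁ b<2 with ≤-antisym (s≤s⁻¹ b<2) a≤b
...       | refl = listed-1123
ripe-d≡a+c R a≤b b≤c | inj₂ c∣a+a | inj₁ refl | refl | inj₂ refl
  with () ← Ripe.noDup R (# 1) (# 2) (λ ()) (inj₁ refl)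
ripe-d≡a+c R a≤b b≤c | inj₂ c∣a+a | inj₂ (refl , _) with ≤-antisym b≤c a≤b
... | refl with Ripe.noDup R (# 0) (# 1) (λ ()) (inj₁ refl)
...   | refl = listed-1112

-- With b = a + p and c = b + q, the hypothesis says a = p + 2q.
ripe-d≡a+b-2c≡2a+b : ∀ {a b c} → Ripe a b c (a + b) → a ≤ b → b ≤ c → a + (a + b) ≡ 2 * c →
                     Listed a b c (a + b)
ripe-d≡a+b-2c≡2a+b {a} R a≤b b≤c e with m≤n⇒∃[o]m+o≡n a≤b
... | p , refl with m≤n⇒∃[o]m+o≡n b≤c
...   | q , refl with +-cancel-common (a + a + p) a (p + q + q) e
                        (solve (a ∷ p ∷ [])) (solve (a ∷ p ∷ q ∷ []))
...     | refl with b∣a+q⊎b∣q+q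
  where
  b∣a+q⊎b∣q+q : p + q + q + p ∣ p + q + q + q ⊎ p + q + q + p ∣ q + q
  b∣a+q⊎b∣q+q with Ripe.div₂ R
  ... | inj₁ b∣a+c = inj₁ (∣-drop-multiple b∣a+c 1 (p + q + q + q) (solve (p ∷ q ∷ [])))
  ... | inj₂ (inj₁ b∣a+d) = inj₂ (∣-drop-multiple b∣a+d 2 (q + q) (solve (p ∷ q ∷ [])))
  ... | inj₂ (inj₂ b∣c+d) = inj₁ (∣-drop-multiple b∣c+d 2 (p + q + q + q) (solve (p ∷ q ∷ [])))
ripe-d≡a+b-2c≡2a+b R a≤b b≤c e | p , refl | q , refl | refl | inj₁ b∣a+q
  with ∣-bounded-sum₂ (ripe-0<d₁ R) a≤b (≤-trans (m≤n+m q (p + q)) a≤b) b∣a+q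
... | inj₁ a+q≡b with +-cancelˡ-≡ (p + q + q) q p a+q≡b
...   | refl with ripe-common-divisor {k = p} R (divides 3 (solve (p ∷ [])))
                   (divides 4 (solve (p ∷ []))) (divides 5 (solve (p ∷ []))) (divides 7 (solve (p ∷ [])))
...     | refl = listed-3457
ripe-d≡a+b-2c≡2a+b R a≤b b≤c e | p , refl | q , refl | refl | inj₁ b∣a+q | inj₂ (_ , q≡b) =
  ⊥-elim (m+m≤n⇒m≢n (≤-trans (ripe-0<d₁ R) a≤b) (≤-trans (+-monoˡ-≤ q (m≤n+m q p)) a≤b) q≡b)
ripe-d≡a+b-2c≡2a+b R a≤b b≤c e | p , refl | q , refl | refl | inj₂ b∣q+q with q ≟ 0
... | yes refl = ⊥-elim (m+m≢1 p (trans p+p≡b (Ripe.noDup R (# 1) (# 2) (λ ()) (inj₁ (+-identityʳ _)))))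
  where
  p+p≡b : p + p ≡ p + 0 + 0 + p
  p+p≡b = cong (_+ p) (sym (trans (+-identityʳ (p + 0)) (+-identityʳ p)))
... | no q≢0 with ∣-bounded-sum₂ (n≢0⇒n>0 q≢0) q≤b q≤b b∣q+q
  where
  q≤b : q ≤ p + q + q + p
  q≤b = ≤-trans (m≤n+m q (p + q)) a≤b
...   | inj₁ q+q≡b = ⊥-elim (m+m≢1 q (trans q+q≡b (trans (sym a≡b) a≡1)))
  where
  a≡b : p + q + q ≡ p + q + q + p
  a≡b = ≤-antisym a≤b (subst (_≤ p + q + q) q+q≡b (+-monoˡ-≤ q (m≤n+m q p)))
  a≡1 : p + q + q ≡ 1
  a≡1 = Ripe.noDup R (# 0) (# 1) (λ ()) (inj₁ (sym a≡b))
ripe-d≡a+b-2c≡2a+b R a≤b b≤c e | p , refl | q , refl | refl | inj₂ b∣q+q | no q≢0 | inj₂ (q≡b , _) =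
  ⊥-elim (m+m≤n⇒m≢n (≤-trans (ripe-0<d₁ R) a≤b) (≤-trans (+-monoˡ-≤ q (m≤n+m q p)) a≤b) q≡b)

-- With b = a + p and c = b + q, the negated equation says a = 2q.
ripe-d≡a+b⇒2c≢a+2b : ∀ {a b c} → Ripe a b c (a + b) → a ≤ b → b ≤ c → b + (a + b) ≢ 2 * c
ripe-d≡a+b⇒2c≢a+2b {a} R a≤b b≤c e with m≤n⇒∃[o]m+o≡n a≤b
... | p , refl with m≤n⇒∃[o]m+o≡n b≤c
...   | q , refl with +-cancel-common (a + a + p + p) a (q + q) e
                        (solve (a ∷ p ∷ [])) (solve (a ∷ p ∷ q ∷ []))
...     | refl with b∣3q⊎b∣a+a
  where
  b∣3q⊎b∣a+a : q + q + p ∣ q + (q + q) ⊎ q + q + p ∣ (q + q) + (q + q)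
  b∣3q⊎b∣a+a with Ripe.div₂ R
  ... | inj₁ b∣a+c = inj₁ (∣-drop-multiple b∣a+c 1 (q + (q + q)) (solve (p ∷ q ∷ [])))
  ... | inj₂ (inj₁ b∣a+d) = inj₂ (∣-drop-multiple b∣a+d 1 ((q + q) + (q + q)) (solve (p ∷ q ∷ [])))
  ... | inj₂ (inj₂ b∣c+d) = inj₁ (∣-drop-multiple b∣c+d 2 (q + (q + q)) (solve (p ∷ q ∷ [])))
ripe-d≡a+b⇒2c≢a+2b R a≤b b≤c e | p , refl | q , refl | refl | inj₁ b∣3q
  with ∣-bounded-sum₃ 0<q q≤b q≤b q≤b b∣3q
  where
  0<q : 0 < q
  0<q = 0<m+m⇒0<m (ripe-0<d₁ R)
  q≤b : q ≤ q + q + p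
  q≤b = ≤-trans (m≤m+n q q) a≤b
... | inj₁ 3q≡b with +-cancel-common (q + q) q p 3q≡b (solve (q ∷ [])) refl
...   | refl = m+m≢1 q (Ripe.noDup R (# 0) (# 2) (λ ()) (inj₂ c≡2a))
  where
  c≡2a : q + q + q + q ≡ 2 * (q + q)
  c≡2a = trans (+-assoc (q + q) q q) (m+m≡2*m (q + q))
ripe-d≡a+b⇒2c≢a+2b R a≤b b≤c e | p , refl | q , refl | refl | inj₁ b∣3q | inj₂ (inj₁ 3q≡2b) =
  n>0⇒n≢0 (0<m+m⇒0<m (ripe-0<d₁ R)) (m+n≡0⇒m≡0 q (sym 0≡q+2p))
  where
  0≡q+2p : 0 ≡ q + (p + p)
  0≡q+2p = +-cancel-common (q + (q + q)) 0 (q + (p + p)) 3q≡2b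
             (solve (q ∷ [])) (solve (p ∷ q ∷ []))
ripe-d≡a+b⇒2c≢a+2b R a≤b b≤c e | p , refl | q , refl | refl | inj₁ b∣3q | inj₂ (inj₂ (q≡b , _)) =
  m+m≤n⇒m≢n (≤-trans (ripe-0<d₁ R) a≤b) a≤b q≡b
ripe-d≡a+b⇒2c≢a+2b R a≤b b≤c e | p , refl | q , refl | refl | inj₂ b∣a+a
  with ∣-bounded-sum₂ (ripe-0<d₁ R) a≤b a≤b b∣a+a
... | inj₁ a+a≡b =
  m+m≢1 q (Ripe.noDup R (# 0) (# 1) (λ ()) (inj₂ (trans (sym a+a≡b) (m+m≡2*m (q + q)))))
... | inj₂ (a≡b , _) = m+m≢1 q (Ripe.noDup R (# 0) (# 1) (λ ()) (inj₁ (sym a≡b)))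

ripe-d≡a+b : ∀ {a b c} → Ripe a b c (a + b) → a ≤ b → b ≤ c → c ≤ a + b → Listed a b c (a + b)
ripe-d≡a+b {a} {b} {c} R a≤b b≤c c≤d with Ripe.div₃ R
... | inj₁ c∣a+b with ∣-bounded-sum₂ (ripe-0<d₁ R) (≤-trans a≤b b≤c) b≤c c∣a+b
...   | inj₁ refl = ripe-c≡d R a≤b b≤c
...   | inj₂ (refl , refl) with Ripe.noDup R (# 1) (# 2) (λ ()) (inj₁ refl)
...     | refl = listed-1112
ripe-d≡a+b {a} {b} R a≤b b≤c c≤d | inj₂ (inj₁ c∣a+d)
  with ∣-bounded-sum₃ (ripe-0<d₁ R) (≤-trans a≤b b≤c) (≤-trans a≤b b≤c) b≤c c∣a+d
... | inj₁ refl = contradiction c≤d (<⇒≱ (m<n+m (a + b) (ripe-0<d₁ R)))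
... | inj₂ (inj₁ 2a+b≡2c) = ripe-d≡a+b-2c≡2a+b R a≤b b≤c 2a+b≡2c
... | inj₂ (inj₂ (refl , _ , refl)) with Ripe.noDup R (# 1) (# 2) (λ ()) (inj₁ refl)
...   | refl = listed-1112
ripe-d≡a+b {a} {b} R a≤b b≤c c≤d | inj₂ (inj₂ c∣b+d)
  with ∣-bounded-sum₃ (≤-trans (ripe-0<d₁ R) a≤b) b≤c (≤-trans a≤b b≤c) b≤c c∣b+d
... | inj₁ refl = contradiction c≤d (<⇒≱ (m<n+m (a + b) (≤-trans (ripe-0<d₁ R) a≤b)))
... | inj₂ (inj₁ a+2b≡2c) = ⊥-elim (ripe-d≡a+b⇒2c≢a+2b R a≤b b≤c a+2b≡2c)
... | inj₂ (inj₂ (refl , refl , _)) with Ripe.noDup R (# 1) (# 2) (λ ()) (inj₁ refl)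
...   | refl = listed-1112

ripe-c≡d∨d≡pair-sum : ∀ {a b c d} → Ripe a b c d → a ≤ b → b ≤ c → c ≤ d →
                      c ≡ d ⊎ d ≡ b + c ⊎ d ≡ a + c ⊎ d ≡ a + b
ripe-c≡d∨d≡pair-sum {a} {b} {c} {d} R a≤b b≤c c≤d =
  [ from-a+b , [ from-a+c , from-b+c ]′ ]′ (Ripe.div₄ R)
  where
  b≤d = ≤-trans b≤c c≤d
  a≤d = ≤-trans a≤b b≤d
  0<a = ripe-0<d₁ R
  from-a+b : d ∣ a + b → c ≡ d ⊎ d ≡ b + c ⊎ d ≡ a + c ⊎ d ≡ a + b
  from-a+b h = [ (λ a+b≡d → inj₂ (inj₂ (inj₂ (sym a+b≡d))))
               , (λ (_ , b≡d) → inj₁ (≤-antisym c≤d (subst (_≤ c) b≡d b≤c))) ]′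
                 (∣-bounded-sum₂ 0<a a≤d b≤d h)
  from-a+c : d ∣ a + c → c ≡ d ⊎ d ≡ b + c ⊎ d ≡ a + c ⊎ d ≡ a + b
  from-a+c h = [ (λ a+c≡d → inj₂ (inj₂ (inj₁ (sym a+c≡d)))) , (λ (_ , c≡d) → inj₁ c≡d) ]′
                 (∣-bounded-sum₂ 0<a a≤d c≤d h)
  from-b+c : d ∣ b + c → c ≡ d ⊎ d ≡ b + c ⊎ d ≡ a + c ⊎ d ≡ a + b
  from-b+c h = [ (λ b+c≡d → inj₂ (inj₁ (sym b+c≡d))) , (λ (_ , c≡d) → inj₁ c≡d) ]′
                 (∣-bounded-sum₂ (≤-trans 0<a a≤b) b≤d c≤d h)

theorem12 : (d₁ d₂ d₃ d₄ : ℕ) → Ripe d₁ d₂ d₃ d₄ →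
    d₁ ≤ d₂ → d₂ ≤ d₃ → d₃ ≤ d₄ →
    (d₁ ≡ 1 × d₂ ≡ 1 × d₃ ≡ 1 × d₄ ≡ 1)
    ⊎ (d₁ ≡ 1 × d₂ ≡ 1 × d₃ ≡ 1 × d₄ ≡ 2)
    ⊎ (d₁ ≡ 1 × d₂ ≡ 1 × d₃ ≡ 2 × d₄ ≡ 3)
    ⊎ (d₁ ≡ 1 × d₂ ≡ 2 × d₃ ≡ 3 × d₄ ≡ 5)
    ⊎ (d₁ ≡ 1 × d₂ ≡ 3 × d₃ ≡ 4 × d₄ ≡ 5)
    ⊎ (d₁ ≡ 2 × d₂ ≡ 3 × d₃ ≡ 5 × d₄ ≡ 7)
    ⊎ (d₁ ≡ 3 × d₂ ≡ 4 × d₃ ≡ 5 × d₄ ≡ 7)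
theorem12 a b c d R a≤b b≤c c≤d with ripe-c≡d∨d≡pair-sum R a≤b b≤c c≤d
... | inj₁ refl = ripe-c≡d R a≤b b≤c
... | inj₂ (inj₁ refl) = ripe-d≡b+c R a≤b b≤c
... | inj₂ (inj₂ (inj₁ refl)) = ripe-d≡a+c R a≤b b≤c
... | inj₂ (inj₂ (inj₂ refl)) = ripe-d≡a+b R a≤b b≤c c≤d
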